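{- (Soundness of $\mathcal{MG}^c$.) For every set $\Gamma\cup\{\varphi\}$ of patterns, if $\Gamma\vdash_{\mathcal{MG}^c}\varphi$ then $\Gamma\models\varphi$.
   Context: Fix a countably infinite set $EVar$ of element variables and a set $\Sigma$ of constant symbols containing a distinguished "definedness symbol" $\lceil\,\rceil$. Patterns: $\varphi::= x\mid \sigma\mid \bot\mid \neg\varphi\mid \varphi\to\varphi\mid \varphi\wedge\varphi\mid\varphi\vee\varphi\mid \varphi\cdot\varphi\mid \forall x\varphi\mid\exists x\varphi$ ($\varphi\cdot\psi$ is application). Abbreviations: $\varphi\leftrightarrow\psi:=(\varphi\to\psi)\wedge(\psi\to\varphi)$, $\lceil\varphi\rceil:=\lceil\,\rceil\cdot\varphi$, $\lfloor\varphi\rfloor:=\neg\lceil\neg\varphi\rceil$, $\varphi=\psi:=\lfloor\varphi\leftrightarrow\psi\rfloor$. Free occurrences, $FV(\varphi)$ as usual (an occurrence of $x$ is bound if inside a subpattern $\forall x\psi$ or $\exists x\psi$). Proof system $\mathcal{MG}^c$ ($\Gamma\vdash\varphi$: finite sequence ending in $\varphi$ of axiom instances, elements of $\Gamma$, or consequences of earlier members by rules). Axioms: $\varphi\vee\varphi\to\varphi$; $\varphi\to\varphi\wedge\varphi$; $\varphi\to\varphi\vee\psi$; $\varphi\wedge\psi\to\varphi$; $\varphi\vee\psi\to\psi\vee\varphi$; $\varphi\wedge\psi\to\psi\wedge\varphi$; $\bot\to\varphi$; $\varphi\vee\neg\varphi$; $\neg\varphi\to(\varphi\to\bot)$; $(\varphi\to\bot)\to\neg\varphi$;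 $\forall x(\varphi\to\psi)\to(\forall x\varphi\to\forall x\psi)$; $\varphi\to\forall x\varphi$ if $x$ does not occur in $\varphi$; $\exists x(x=y)$ for $y$ distinct from $x$; $\exists x\varphi\to\neg\forall x\neg\varphi$; $\neg\forall x\neg\varphi\to\exists x\varphi$; $(\varphi\vee\psi)\cdot\chi\to\varphi\cdot\chi\vee\psi\cdot\chi$; $\chi\cdot(\varphi\vee\psi)\to\chi\cdot\varphi\vee\chi\cdot\psi$; $(\exists x\varphi)\cdot\psi\to\exists x(\varphi\cdot\psi)$ and $\psi\cdot(\exists x\varphi)\to\exists x(\psi\cdot\varphi)$ if $x$ does not occur in $\psi$; $\lceil\varphi\rceil\cdot\psi\to\lceil\varphi\rceil$; $\psi\cdot\lceil\varphi\rceil\to\lceil\varphi\rceil$; $\lceil x\rceil$; $\varphi\to\lceil\varphi\rceil$; $\lceil\bot\rceil\to\bot$. Rules: from $\varphi$, $\varphi\to\psi$ infer $\psi$; from $\varphi\to\psi$, $\psi\to\chi$ infer $\varphi\to\chi$; from $\varphi\wedge\psi\to\chi$ infer $\varphi\to(\psi\to\chi)$; from $\varphi\to(\psi\to\chi)$ infer $\varphi\wedge\psi\to\chi$; from $\varphi\to\psi$ infer $\chi\vee\varphi\to\chi\vee\psi$; from $\varphi$ infer $\forall x\varphi$; from $\varphi\to\psi$ infer $\varphi\cdot\chi\to\psi\cdot\chi$ and $\chi\cdot\varphi\to\chi\cdot\psi$. Semantics: a model is a nonempty set $M$ with a map $\cdot_M:M\times M\to\mathcal P(M)$ and a subset $\sigma_M\subseteq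 M$ for each $\sigma\in\Sigma$. For a valuation $e:EVar\to M$ the extension is: $|x|_e=\{e(x)\}$, $|\sigma|_e=\sigma_M$, $|\bot|_e=\emptyset$, $|\neg\varphi|_e=M\setminus|\varphi|_e$, $|\varphi\to\psi|_e=(M\setminus|\varphi|_e)\cup|\psi|_e$, $\wedge,\vee$ as intersection, union, $|\varphi\cdot\psi|_e=\bigcup_{a\in|\varphi|_e,b\in|\psi|_e}a\cdot_M b$, $|\exists x\varphi|_e=\bigcup_{a\in M}|\varphi|_{e[x\mapsto a]}$, $|\forall x\varphi|_e=\bigcap_{a\in M}|\varphi|_{e[x\mapsto a]}$. $M\models\varphi$ iff $|\varphi|_e=M$ for all $e$. Models of this logic are required to satisfy the definedness condition $M\models\lceil x\rceil$. $\Gamma\models\varphi$ means: every such model $M$ with $M\models\gamma$ for all $\gamma\in\Gamma$ satisfies $M\models\varphi$. -}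

module Defs where

open import Level using (Level; suc; Lift)
open import Data.Nat using (ℕ; _≟_)
open import Data.Empty using (⊥)
open import Data.Sum using (_⊎_)
open import Data.Product using (Σ; _×_)
open import Relation.Nullary using (¬_; yes; no)
open import Relation.Binary.PropositionalEquality using (_≡_; _≢_)

EVar : Set
EVar = ℕ

record Signature : Set₁ where
  field
    Symb    : Set
    ceilSym : Symb

data Pattern (Sym : Set) : Set where
  var  : EVar → Pattern Sym
  sym  : Sym → Pattern Sym
  bot  : Pattern Sym
  neg  : Pattern Sym → Pattern Sym
  _⇒_  : Pattern Sym → Pattern Sym → Pattern Sym
  _∧ₚ_ : Pattern Sym → Pattern Sym → Pattern Sym
  _∨ₚ_ : Pattern Sym → Pattern Sym → Pattern Sym
  _·_  : Pattern Sym → Pattern Sym → Pattern Sym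
  all  : EVar → Pattern Sym → Pattern Sym
  ex   : EVar → Pattern Sym → Pattern Sym

infixr 4 _⇒_
infixr 6 _∧ₚ_
infixr 5 _∨ₚ_
infixl 8 _·_

-- "x occurs in φ": x appears as a variable (free or bound occurrence).
data Occurs {Sym : Set} (x : EVar) : Pattern Sym → Set where
  o-var  : Occurs x (var x)
  o-neg  : ∀ {φ} → Occurs x φ → Occurs x (neg φ)
  o-⇒ˡ   : ∀ {φ ψ} → Occurs x φ → Occurs x (φ ⇒ ψ)
  o-⇒ʳ   : ∀ {φ ψ} → Occurs x ψ → Occurs x (φ ⇒ ψ)
  o-∧ˡ   : ∀ {φ ψ} → Occurs x φ → Occurs x (φ ∧ₚ ψ)
  o-∧ʳ   : ∀ {φ ψ} → Occurs x ψ → Occurs x (φ ∧ₚ ψ)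
  o-∨ˡ   : ∀ {φ ψ} → Occurs x φ → Occurs x (φ ∨ₚ ψ)
  o-∨ʳ   : ∀ {φ ψ} → Occurs x ψ → Occurs x (φ ∨ₚ ψ)
  o-·ˡ   : ∀ {φ ψ} → Occurs x φ → Occurs x (φ · ψ)
  o-·ʳ   : ∀ {φ ψ} → Occurs x ψ → Occurs x (φ · ψ)
  o-all  : ∀ {y φ} → Occurs x φ → Occurs x (all y φ)
  o-ex   : ∀ {y φ} → Occurs x φ → Occurs x (ex y φ)

module _ (S : Signature) where
  open Signature S

  Pat : Set
  Pat = Pattern Symb

  _⇔_ : Pat → Pat → Pat
  φ ⇔ ψ = (φ ⇒ ψ) ∧ₚ (ψ ⇒ φ)

  ⌈_⌉ : Pat → Pat
  ⌈ φ ⌉ = sym ceilSym · φ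

  ⌊_⌋ : Pat → Pat
  ⌊ φ ⌋ = neg ⌈ neg φ ⌉

  _≐_ : Pat → Pat → Pat
  φ ≐ ψ = ⌊ φ ⇔ ψ ⌋

  -- The proof system MG^c.  Γ is a set of patterns (a predicate);
  -- derivations are trees, equivalent to the finite sequences of the paper.
  data _⊢_ (Γ : Pat → Set) : Pat → Set where
    ax-∨-idem   : ∀ φ → Γ ⊢ (φ ∨ₚ φ ⇒ φ)
    ax-∧-dup    : ∀ φ → Γ ⊢ (φ ⇒ φ ∧ₚ φ)
    ax-∨-intro  : ∀ φ ψ → Γ ⊢ (φ ⇒ φ ∨ₚ ψ)
    ax-∧-elim   : ∀ φ ψ → Γ ⊢ (φ ∧ₚ ψ ⇒ φ)
    ax-∨-comm   : ∀ φ ψ → Γ ⊢ (φ ∨ₚ ψ ⇒ ψ ∨ₚ φ)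
    ax-∧-comm   : ∀ φ ψ → Γ ⊢ (φ ∧ₚ ψ ⇒ ψ ∧ₚ φ)
    ax-bot      : ∀ φ → Γ ⊢ (bot ⇒ φ)
    ax-lem      : ∀ φ → Γ ⊢ (φ ∨ₚ neg φ)
    ax-neg-to   : ∀ φ → Γ ⊢ (neg φ ⇒ (φ ⇒ bot))
    ax-to-neg   : ∀ φ → Γ ⊢ ((φ ⇒ bot) ⇒ neg φ)
    ax-∀-K      : ∀ x φ ψ → Γ ⊢ (all x (φ ⇒ ψ) ⇒ (all x φ ⇒ all x ψ))
    ax-∀-vac    : ∀ x φ → ¬ Occurs x φ → Γ ⊢ (φ ⇒ all x φ)
    ax-exists   : ∀ x y → x ≢ y → Γ ⊢ ex x (var x ≐ var y)
    ax-∃-¬∀¬    : ∀ x φ → Γ ⊢ (ex x φ ⇒ neg (all x (neg φ)))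
    ax-¬∀¬-∃    : ∀ x φ → Γ ⊢ (neg (all x (neg φ)) ⇒ ex x φ)
    ax-prop-∨ˡ  : ∀ φ ψ χ → Γ ⊢ ((φ ∨ₚ ψ) · χ ⇒ φ · χ ∨ₚ ψ · χ)
    ax-prop-∨ʳ  : ∀ φ ψ χ → Γ ⊢ (χ · (φ ∨ₚ ψ) ⇒ χ · φ ∨ₚ χ · ψ)
    ax-prop-∃ˡ  : ∀ x φ ψ → ¬ Occurs x ψ → Γ ⊢ ((ex x φ) · ψ ⇒ ex x (φ · ψ))
    ax-prop-∃ʳ  : ∀ x φ ψ → ¬ Occurs x ψ → Γ ⊢ (ψ · (ex x φ) ⇒ ex x (ψ · φ))
    ax-ceilˡ    : ∀ φ ψ → Γ ⊢ (⌈ φ ⌉ · ψ ⇒ ⌈ φ ⌉)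
    ax-ceilʳ    : ∀ φ ψ → Γ ⊢ (ψ · ⌈ φ ⌉ ⇒ ⌈ φ ⌉)
    ax-def      : ∀ x → Γ ⊢ ⌈ var x ⌉
    ax-ceil-in  : ∀ φ → Γ ⊢ (φ ⇒ ⌈ φ ⌉)
    ax-ceil-bot : Γ ⊢ (⌈ bot ⌉ ⇒ bot)
    hyp         : ∀ {φ} → Γ φ → Γ ⊢ φ
    mp          : ∀ {φ ψ} → Γ ⊢ φ → Γ ⊢ (φ ⇒ ψ) → Γ ⊢ ψ
    syll        : ∀ {φ ψ χ} → Γ ⊢ (φ ⇒ ψ) → Γ ⊢ (ψ ⇒ χ) → Γ ⊢ (φ ⇒ χ)
    exportation : ∀ {φ ψ χ} → Γ ⊢ (φ ∧ₚ ψ ⇒ χ) → Γ ⊢ (φ ⇒ (ψ ⇒ χ))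
    importation : ∀ {φ ψ χ} → Γ ⊢ (φ ⇒ (ψ ⇒ χ)) → Γ ⊢ (φ ∧ₚ ψ ⇒ χ)
    expansion   : ∀ {φ ψ} χ → Γ ⊢ (φ ⇒ ψ) → Γ ⊢ (χ ∨ₚ φ ⇒ χ ∨ₚ ψ)
    gen         : ∀ {φ} x → Γ ⊢ φ → Γ ⊢ all x φ
    framingˡ    : ∀ {φ ψ} χ → Γ ⊢ (φ ⇒ ψ) → Γ ⊢ (φ · χ ⇒ ψ · χ)
    framingʳ    : ∀ {φ ψ} χ → Γ ⊢ (φ ⇒ ψ) → Γ ⊢ (χ · φ ⇒ χ · ψ)

  -- Semantics.  Subsets of the carrier are predicates Carrier → Set ℓ.
  record Model (ℓ : Level) : Set (suc ℓ) where
    field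
      Carrier  : Set ℓ
      inhabit  : Carrier
      _∙_∋_    : Carrier → Carrier → Carrier → Set ℓ  -- c ∈ a ·_M b
      ⟦_⟧ˢ     : Symb → Carrier → Set ℓ

  module _ {ℓ : Level} (M : Model ℓ) where
    open Model M

    Valuation : Set ℓ
    Valuation = EVar → Carrier

    _[_↦_] : Valuation → EVar → Carrier → Valuation
    (e [ x ↦ a ]) y with y ≟ x
    ... | yes _ = a
    ... | no  _ = e y

    ext : Pat → Valuation → Carrier → Set ℓ
    ext (var x)  e m = m ≡ e x
    ext (sym σ)  e m = ⟦ σ ⟧ˢ m
    ext bot      e m = Lift ℓ ⊥
    ext (neg φ)  e m = ¬ ext φ e m
    ext (φ ⇒ ψ)  e m = (¬ ext φ e m) ⊎ ext ψ e m
    ext (φ ∧ₚ ψ) e m = ext φ e m × ext ψ e m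
    ext (φ ∨ₚ ψ) e m = ext φ e m ⊎ ext ψ e m
    ext (φ · ψ)  e m = Σ Carrier λ a → Σ Carrier λ b →
                         ext φ e a × ext ψ e b × (a ∙ b ∋ m)
    ext (all x φ) e m = ∀ a → ext φ (e [ x ↦ a ]) m
    ext (ex x φ)  e m = Σ Carrier λ a → ext φ (e [ x ↦ a ]) m

    _⊨_ : Pat → Set ℓ
    _⊨_ φ = ∀ (e : Valuation) (m : Carrier) → ext φ e m

    Definedness : Set ℓ
    Definedness = ∀ (x : EVar) → _⊨_ ⌈ var x ⌉

  Consequence : (ℓ : Level) → (Pat → Set) → Pat → Set (suc ℓ)
  Consequence ℓ Γ φ = (M : Model ℓ) → Definedness M →
                      (∀ γ → Γ γ → _⊨_ M γ) → _⊨_ M φ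

-- Read every pattern as the set of elements it matches; then each axiom
-- denotes the whole carrier and each rule preserves this.  Two facts carry
-- the argument beyond bookkeeping: the extension of a pattern depends only
-- on the variables occurring in it (which justifies the side conditions of
-- the vacuous-∀ and ∃-propagation axioms), and the definedness condition
-- makes ⌈φ⌉ the whole carrier as soon as φ matches some element.  Since
-- φ → ψ denotes the union of the complement of |φ| with |ψ|, turning a
-- pointwise implication into membership of that union needs excluded middle.
module Submission where

open import Defs
open import Level using (Level; lift)
open import Axiom.ExcludedMiddle using (ExcludedMiddle)
open import Data.Nat using (_≟_)
open import Data.Empty using (⊥-elim)
open import Data.Sum as Sum using (_⊎_; inj₁; inj₂)
open import Data.Product as Product using (_,_; proj₁)
open import Function using (_∘_)
open import Relation.Nullary using (¬_; Dec; yes; no)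
open import Relation.Nullary.Decidable using (toSum; decidable-stable)
open import Relation.Binary.PropositionalEquality using (_≡_; _≢_; refl; trans)
  renaming (sym to ≡-sym)

dec-→⇒¬⊎ : ∀ {a b} {A : Set a} {B : Set b} → Dec A → (A → B) → ¬ A ⊎ B
dec-→⇒¬⊎ (yes a) f = inj₂ (f a)
dec-→⇒¬⊎ (no ¬a) f = inj₁ ¬a

¬⊎⇒→ : ∀ {a b} {A : Set a} {B : Set b} → ¬ A ⊎ B → A → B
¬⊎⇒→ (inj₁ ¬a) a = ⊥-elim (¬a a)
¬⊎⇒→ (inj₂ b)  _ = b

module Semantics (S : Signature) {ℓ : Level} (M : Model S ℓ) where
  open Model M

  ⟦_⟧ : Pat S → Valuation S M → Carrier → Set ℓ
  ⟦_⟧ = ext S M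

  _[_≔_] : Valuation S M → EVar → Carrier → Valuation S M
  _[_≔_] = _[_↦_] S M

  update-updates : ∀ e x a → (e [ x ≔ a ]) x ≡ a
  update-updates e x a with x ≟ x
  ... | yes _  = refl
  ... | no x≢x = ⊥-elim (x≢x refl)

  update-minimal : ∀ e {x y} a → y ≢ x → (e [ x ≔ a ]) y ≡ e y
  update-minimal e {x} {y} a y≢x with y ≟ x
  ... | yes y≡x = ⊥-elim (y≢x y≡x)
  ... | no _    = refl

  AgreeOn : Pat S → Valuation S M → Valuation S M → Set ℓ
  AgreeOn φ e e′ = ∀ {y} → Occurs y φ → e y ≡ e′ y

  update-agreeOn : ∀ {φ e e′} x a → AgreeOn φ e e′ → AgreeOn φ (e [ x ≔ a ]) (e′ [ x ≔ a ])
  update-agreeOn x a agree {y} o with y ≟ x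
  ... | yes _ = refl
  ... | no _  = agree o

  ext-agreeOn : ∀ φ {e e′ m} → AgreeOn φ e e′ → ⟦ φ ⟧ e m → ⟦ φ ⟧ e′ m
  ext-agreeOn (var x)   agree p = trans p (agree o-var)
  ext-agreeOn (sym σ)   agree p = p
  ext-agreeOn bot       agree p = p
  ext-agreeOn (neg φ)   agree p q = p (ext-agreeOn φ (≡-sym ∘ agree ∘ o-neg) q)
  ext-agreeOn (φ ⇒ ψ)   agree =
    Sum.map (λ ¬p q → ¬p (ext-agreeOn φ (≡-sym ∘ agree ∘ o-⇒ˡ) q)) (ext-agreeOn ψ (agree ∘ o-⇒ʳ))
  ext-agreeOn (φ ∧ₚ ψ)  agree =
    Product.map (ext-agreeOn φ (agree ∘ o-∧ˡ)) (ext-agreeOn ψ (agree ∘ o-∧ʳ))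
  ext-agreeOn (φ ∨ₚ ψ)  agree =
    Sum.map (ext-agreeOn φ (agree ∘ o-∨ˡ)) (ext-agreeOn ψ (agree ∘ o-∨ʳ))
  ext-agreeOn (φ · ψ)   agree (a , b , p , q , a∙b∋m) =
    a , b , ext-agreeOn φ (agree ∘ o-·ˡ) p , ext-agreeOn ψ (agree ∘ o-·ʳ) q , a∙b∋m
  ext-agreeOn (all x φ) agree p a = ext-agreeOn φ (update-agreeOn x a (agree ∘ o-all)) (p a)
  ext-agreeOn (ex x φ)  agree (a , p) = a , ext-agreeOn φ (update-agreeOn x a (agree ∘ o-ex)) p

  ext-update-fresh : ∀ φ {e x m} a → ¬ Occurs x φ → ⟦ φ ⟧ e m → ⟦ φ ⟧ (e [ x ≔ a ]) m
  ext-update-fresh φ {e} a x∉φ =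
    ext-agreeOn φ λ o → ≡-sym (update-minimal e a λ { refl → x∉φ o })

  ⌊⌋-intro : ∀ φ {e m} → (∀ b → ⟦ φ ⟧ e b) → ⟦ ⌊_⌋ S φ ⟧ e m
  ⌊⌋-intro φ φ-total (_ , b , _ , ¬φb , _) = ¬φb (φ-total b)

  -- Definedness at a valuation sending a variable to b puts every m into ⌈⌉_M · b.
  ⌈⌉-total : Definedness S M → ∀ φ {e b} → ⟦ φ ⟧ e b → ∀ m → ⟦ ⌈_⌉ S φ ⟧ e m
  ⌈⌉-total definedness φ {b = b} φb m with definedness 0 (λ _ → b) m
  ... | a , _ , ⌈⌉a , refl , a∙b∋m = a , b , ⌈⌉a , φb , a∙b∋m

module Soundness {ℓ : Level} (em : ExcludedMiddle ℓ) (S : Signature)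
                 (M : Model S ℓ) (definedness : Definedness S M) where
  open Semantics S M

  ⇒-intro : {A B : Set ℓ} → (A → B) → ¬ A ⊎ B
  ⇒-intro = dec-→⇒¬⊎ em

  ≐-var-intro : ∀ x y e {m} → e x ≡ e y → ⟦ _≐_ S (var x) (var y) ⟧ e m
  ≐-var-intro x y e ex≡ey = ⌊⌋-intro (_⇔_ S (var x) (var y)) λ _ →
    ⇒-intro (λ p → trans p ex≡ey) , ⇒-intro (λ p → trans p (≡-sym ex≡ey))

  ex-var-≐-valid : ∀ {x y} → x ≢ y → ∀ e m → ⟦ ex x (_≐_ S (var x) (var y)) ⟧ e m
  ex-var-≐-valid {x} {y} x≢y e m =
    e y , ≐-var-intro x y (e [ x ≔ e y ])
            (trans (update-updates e x (e y)) (≡-sym (update-minimal e (e y) (x≢y ∘ ≡-sym))))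

  module _ {Γ : Pat S → Set} (Γ-valid : ∀ γ → Γ γ → _⊨_ S M γ) where

    sound : ∀ {φ} → _⊢_ S Γ φ → _⊨_ S M φ
    sound (ax-∨-idem φ)     e m = ⇒-intro Sum.reduce
    sound (ax-∧-dup φ)      e m = ⇒-intro λ p → p , p
    sound (ax-∨-intro φ ψ)  e m = ⇒-intro inj₁
    sound (ax-∧-elim φ ψ)   e m = ⇒-intro proj₁
    sound (ax-∨-comm φ ψ)   e m = ⇒-intro Sum.swap
    sound (ax-∧-comm φ ψ)   e m = ⇒-intro Product.swap
    sound (ax-bot φ)        e m = inj₁ λ { (lift ()) }
    sound (ax-lem φ)        e m = toSum em
    sound (ax-neg-to φ)     e m = ⇒-intro inj₁
    sound (ax-to-neg φ)     e m = ⇒-intro λ { (inj₁ ¬p) → ¬p ; (inj₂ (lift ())) }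
    sound (ax-∀-K x φ ψ)    e m = ⇒-intro λ φ⇒ψ → ⇒-intro λ φ′ a → ¬⊎⇒→ (φ⇒ψ a) (φ′ a)
    sound (ax-∀-vac x φ x∉φ) e m = ⇒-intro λ p a → ext-update-fresh φ a x∉φ p
    sound (ax-exists x y x≢y) = ex-var-≐-valid x≢y
    sound (ax-∃-¬∀¬ x φ)    e m = ⇒-intro λ { (a , p) ∀¬φ → ∀¬φ a p }
    sound (ax-¬∀¬-∃ x φ)    e m = ⇒-intro λ ¬∀¬φ → decidable-stable em λ ¬∃φ → ¬∀¬φ λ a p → ¬∃φ (a , p)
    sound (ax-prop-∨ˡ φ ψ χ) e m = ⇒-intro λ
      { (a , b , inj₁ p , q , r) → inj₁ (a , b , p , q , r)
      ; (a , b , inj₂ p , q , r) → inj₂ (a , b , p , q , r) }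
    sound (ax-prop-∨ʳ φ ψ χ) e m = ⇒-intro λ
      { (a , b , q , inj₁ p , r) → inj₁ (a , b , q , p , r)
      ; (a , b , q , inj₂ p , r) → inj₂ (a , b , q , p , r) }
    sound (ax-prop-∃ˡ x φ ψ x∉ψ) e m = ⇒-intro λ
      { (a , b , (c , p) , q , r) → c , a , b , p , ext-update-fresh ψ c x∉ψ q , r }
    sound (ax-prop-∃ʳ x φ ψ x∉ψ) e m = ⇒-intro λ
      { (a , b , q , (c , p) , r) → c , a , b , ext-update-fresh ψ c x∉ψ q , p , r }
    sound (ax-ceilˡ φ ψ)    e m = ⇒-intro λ
      { (_ , _ , (_ , _ , _ , p , _) , _) → ⌈⌉-total definedness φ p m }
    sound (ax-ceilʳ φ ψ)    e m = ⇒-intro λ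
      { (_ , _ , _ , (_ , _ , _ , p , _) , _) → ⌈⌉-total definedness φ p m }
    sound (ax-def x)            = definedness x
    sound (ax-ceil-in φ)    e m = ⇒-intro λ p → ⌈⌉-total definedness φ p m
    sound ax-ceil-bot       e m = ⇒-intro λ { (_ , _ , _ , lift () , _) }
    sound (hyp {φ} γ)           = Γ-valid φ γ
    sound (mp ⊢φ ⊢φ⇒ψ)      e m = ¬⊎⇒→ (sound ⊢φ⇒ψ e m) (sound ⊢φ e m)
    sound (syll ⊢φ⇒ψ ⊢ψ⇒χ)  e m = ⇒-intro (¬⊎⇒→ (sound ⊢ψ⇒χ e m) ∘ ¬⊎⇒→ (sound ⊢φ⇒ψ e m))
    sound (exportation ⊢φ∧ψ⇒χ) e m =
      ⇒-intro λ p → ⇒-intro λ q → ¬⊎⇒→ (sound ⊢φ∧ψ⇒χ e m) (p , q)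
    sound (importation ⊢φ⇒ψ⇒χ) e m =
      ⇒-intro λ { (p , q) → ¬⊎⇒→ (¬⊎⇒→ (sound ⊢φ⇒ψ⇒χ e m) p) q }
    sound (expansion χ ⊢φ⇒ψ) e m = ⇒-intro (Sum.map₂ (¬⊎⇒→ (sound ⊢φ⇒ψ e m)))
    sound (gen x ⊢φ)        e m a = sound ⊢φ (e [ x ≔ a ]) m
    sound (framingˡ χ ⊢φ⇒ψ) e m = ⇒-intro λ
      { (a , b , p , q , r) → a , b , ¬⊎⇒→ (sound ⊢φ⇒ψ e a) p , q , r }
    sound (framingʳ χ ⊢φ⇒ψ) e m = ⇒-intro λ
      { (a , b , q , p , r) → a , b , q , ¬⊎⇒→ (sound ⊢φ⇒ψ e b) p , r }

mainTheorem3 : ∀ {ℓ : Level} → ExcludedMiddle ℓ →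
    (S : Signature) (Γ : Pat S → Set) (φ : Pat S) →
    _⊢_ S Γ φ → Consequence S ℓ Γ φ
mainTheorem3 em S Γ φ ⊢φ M definedness Γ-valid =
  Soundness.sound em S M definedness Γ-valid ⊢φ
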